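{- There exists a function $f \colon \mathbb{N} \to \mathbb{N}$ such that the following holds. Let $t \geq 3$ be an integer, let $G$ be a $\{P_6, K_{2,t}\}$-free graph, let $S$ be a minimal separator of $G$ with $\alpha(S) \geq f(t)$, and let $C_1$ and $C_2$ be two $S$-full components of $G - S$. Then $G$ contains, as an induced subgraph, a $t$-pyramid $\Pi$ with presentation $(a, x_1, \dots, x_t, y_1, \dots, y_t)$ such that $V(\Pi) \cap S = \{x_1, \dots, x_t\}$, and there exists $i \in \{1,2\}$ with $a \in V(C_i)$ and $\{y_1, \dots, y_t\} \subseteq V(C_{3-i})$.
   Context: All graphs are finite and simple; $P_6$ is the path on $6$ vertices and $K_{2,t}$ the complete bipartite graph with parts of sizes $2$ and $t$; $\{P_6,K_{2,t}\}$-free means no induced subgraph isomorphic to either. For $t\ge 2$, a $t$-pyramid is a graph on vertices $a, x_1,\dots,x_t, y_1,\dots,y_t$ with edge set $\{a x_i : i\in[t]\} \cup \{x_i y_i : i \in [t]\} \cup \{y_i y_j : i \neq j\}$; the tuple $(a,x_1,\dots,x_t,y_1,\dots,y_t)$ is its presentation. A set $S \subseteq V(G)$ is a minimal separator if there are vertices $u,v$ such that $S$ is an inclusion-wise minimal set of vertices not containing $u,v$ that intersects every $(u,v)$-path; equivalently, $G-S$ has two distinct components $C, C'$ with $N_G(C) = N_G(C') = S$. A component $C$ of $G - S$ is $S$-full if $N_G(V(C)) = S$. $\alpha(S)$ is the maximum size of an independent set of $G$ contained in $S$. -}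

module Defs where

open import Data.Nat using (ℕ; zero; suc; _+_; _≤_; _<_)
open import Data.Fin using (Fin; toℕ)
open import Data.Bool using (Bool; true; false; _∧_; _∨_; not)
open import Data.List using (List; length)
open import Data.List.Membership.Propositional using (_∈_)
open import Data.List.Relation.Unary.Unique.Propositional using (Unique)
open import Data.Product using (Σ; _×_; ∃; _,_)
open import Data.Sum using (_⊎_)
open import Relation.Nullary using (¬_)
open import Relation.Binary.PropositionalEquality using (_≡_; _≢_)

record Graph : Set where
  field
    n     : ℕ
    adj   : Fin n → Fin n → Bool
    sym   : ∀ u v → adj u v ≡ adj v u
    irrefl : ∀ v → adj v v ≡ false
open Graph public

V : Graph → Set
V G = Fin (n G)

VSet : Graph → Set
VSet G = V G → Bool

_∈ᵥ_ : ∀ {m} → Fin m → (Fin m → Bool) → Set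
v ∈ᵥ A = A v ≡ true

_∉ᵥ_ : ∀ {m} → Fin m → (Fin m → Bool) → Set
v ∉ᵥ A = A v ≡ false

record InducedSub (H G : Graph) : Set where
  field
    φ     : V H → V G
    inj   : ∀ i j → φ i ≡ φ j → i ≡ j
    pres  : ∀ i j → adj G (φ i) (φ j) ≡ adj H i j

_∈Free_ : Graph → Graph → Set
G ∈Free H = ¬ InducedSub H G

_==ℕ_ : ℕ → ℕ → Bool
zero  ==ℕ zero  = true
zero  ==ℕ suc _ = false
suc _ ==ℕ zero  = false
suc a ==ℕ suc b = a ==ℕ b

_<ᵇ_ : ℕ → ℕ → Bool
_     <ᵇ zero  = false
zero  <ᵇ suc _ = true
suc a <ᵇ suc b = a <ᵇ b

==ℕ-sym : ∀ a b → (a ==ℕ b) ≡ (b ==ℕ a)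
==ℕ-sym zero zero = _≡_.refl
==ℕ-sym zero (suc b) = _≡_.refl
==ℕ-sym (suc a) zero = _≡_.refl
==ℕ-sym (suc a) (suc b) = ==ℕ-sym a b

==ℕ-refl : ∀ a → (a ==ℕ a) ≡ true
==ℕ-refl zero = _≡_.refl
==ℕ-refl (suc a) = ==ℕ-refl a

p6adj : ℕ → ℕ → Bool
p6adj a b = (suc a ==ℕ b) ∨ (suc b ==ℕ a)

p6sym : ∀ a b → p6adj a b ≡ p6adj b a
p6sym a b with suc a ==ℕ b | suc b ==ℕ a
... | true  | true  = _≡_.refl
... | true  | false = _≡_.refl
... | false | true  = _≡_.refl
... | false | false = _≡_.refl

sa≠a : ∀ a → (suc a ==ℕ a) ≡ false
sa≠a zero = _≡_.refl
sa≠a (suc a) = sa≠a a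

P6 : Graph
P6 = record
  { n = 6
  ; adj = λ i j → p6adj (toℕ i) (toℕ j)
  ; sym = λ i j → p6sym (toℕ i) (toℕ j)
  ; irrefl = λ i → irr (toℕ i)
  }
  where
  irr : ∀ a → p6adj a a ≡ false
  irr a rewrite sa≠a a = _≡_.refl

-- K_{2,t}: vertices 0,1 form one side, 2..t+1 the other.
kadj : ℕ → ℕ → Bool
kadj a b = (a <ᵇ 2) ∧ not (b <ᵇ 2) ∨ not (a <ᵇ 2) ∧ (b <ᵇ 2)

K2 : ℕ → Graph
K2 t = record
  { n = 2 + t
  ; adj = λ i j → kadj (toℕ i) (toℕ j)
  ; sym = λ i j → ksym (toℕ i) (toℕ j)
  ; irrefl = λ i → kirr (toℕ i)
  }
  where
  ksym : ∀ a b → kadj a b ≡ kadj b a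
  ksym a b with a <ᵇ 2 | b <ᵇ 2
  ... | true  | true  = _≡_.refl
  ... | true  | false = _≡_.refl
  ... | false | true  = _≡_.refl
  ... | false | false = _≡_.refl
  kirr : ∀ a → kadj a a ≡ false
  kirr a with a <ᵇ 2
  ... | true  = _≡_.refl
  ... | false = _≡_.refl

data WalkIn (G : Graph) (P : V G → Set) : V G → V G → Set where
  here : ∀ {u} → P u → WalkIn G P u u
  step : ∀ {u w v} → P u → adj G u w ≡ true → WalkIn G P w v → WalkIn G P u v

Outside : (G : Graph) → VSet G → V G → Set
Outside G T v = v ∉ᵥ T

Separates : (G : Graph) → VSet G → V G → V G → Set
Separates G T u v = (u ∉ᵥ T) × (v ∉ᵥ T) × ¬ WalkIn G (Outside G T) u v

_⊆ᵥ_ : ∀ {m} → (Fin m → Bool) → (Fin m → Bool) → Set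
_⊆ᵥ_ {m} T S = ∀ (v : Fin m) → v ∈ᵥ T → v ∈ᵥ S

MinimalSeparator : (G : Graph) → VSet G → Set
MinimalSeparator G S =
  Σ (V G) λ u → Σ (V G) λ v →
    Separates G S u v ×
    (∀ (T : VSet G) → T ⊆ᵥ S → (Σ (V G) λ s → (s ∈ᵥ S) × (s ∉ᵥ T)) →
       ¬ Separates G T u v)

IsComponent : (G : Graph) → VSet G → VSet G → Set
IsComponent G S C =
  (Σ (V G) λ v → v ∈ᵥ C) ×
  (∀ v → v ∈ᵥ C → v ∉ᵥ S) ×
  (∀ u v → u ∈ᵥ C → v ∈ᵥ C → WalkIn G (λ w → w ∈ᵥ C) u v) ×
  (∀ u w → u ∈ᵥ C → w ∉ᵥ S → adj G u w ≡ true → w ∈ᵥ C)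

InNbhd : (G : Graph) → VSet G → V G → Set
InNbhd G C w = (w ∉ᵥ C) × (Σ (V G) λ u → (u ∈ᵥ C) × (adj G u w ≡ true))

IsFullComponent : (G : Graph) → VSet G → VSet G → Set
IsFullComponent G S C =
  IsComponent G S C ×
  (∀ w → InNbhd G C w → w ∈ᵥ S) ×
  (∀ w → w ∈ᵥ S → InNbhd G C w)

AlphaAtLeast : (G : Graph) → VSet G → ℕ → Set
AlphaAtLeast G S k =
  Σ (List (V G)) λ I →
    Unique I × (∀ v → v ∈ I → v ∈ᵥ S) ×
    (∀ u v → u ∈ I → v ∈ I → adj G u v ≡ false) × (k ≤ length I)

record InducedPyramid (G : Graph) (t : ℕ) (a : V G) (x y : Fin t → V G) : Set where
  field
    a≢x  : ∀ i → a ≢ x i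
    a≢y  : ∀ i → a ≢ y i
    x≢y  : ∀ i j → x i ≢ y j
    x-inj : ∀ i j → x i ≡ x j → i ≡ j
    y-inj : ∀ i j → y i ≡ y j → i ≡ j
    a-x  : ∀ i → adj G a (x i) ≡ true
    a-y  : ∀ i → adj G a (y i) ≡ false
    x-x  : ∀ i j → i ≢ j → adj G (x i) (x j) ≡ false
    x-y≡ : ∀ i → adj G (x i) (y i) ≡ true
    x-y≢ : ∀ i j → i ≢ j → adj G (x i) (y j) ≡ false
    y-y  : ∀ i j → i ≢ j → adj G (y i) (y j) ≡ true

-- Fix cᵢ ∈ Cᵢ and a large independent set I ⊆ S. Suppose a vertex a of one full component has a
-- large set X ⊆ I of neighbours; it will be the apex. Fix c₀ in the other full component D. By
-- P₆-freeness every x ∈ X missing c₀ has a common neighbour y(x) with c₀ in D, and by K₂,ₜ-freeness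
-- every vertex of D sees fewer than t vertices of X. So a greedy selection finds t such vertices xᵢ
-- with xᵢ ≁ y(xⱼ) for i ≠ j, and the y(xᵢ) are pairwise adjacent, since otherwise
-- y(xᵢ) – c₀ – y(xⱼ) – xⱼ – a – x′ is an induced P₆ for any x′ ∈ X missing y(xᵢ), y(xⱼ) and c₀.
-- If neither c₁ nor c₂ is such an apex, they miss most of I, and each remaining s ∈ I has a common
-- neighbour yᵢ(s) with cᵢ in Cᵢ. If no yᵢ(s) is an apex either, greedy selection finds s₁, s₂, s₃
-- such that sⱼ ≁ yᵢ(sₖ) for j ≠ k, and then s₁ – y₁(s₁) – y₁(s₂) – s₂ – y₂(s₂) – y₂(s₃) is an
-- induced P₆.

module Submission where

open import Defs hiding (sym)
open import Data.Bool using (Bool; true; false)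
open import Data.Bool.Properties using (¬-not; not-¬) renaming (_≟_ to _≟ᵇ_)
open import Data.Empty using (⊥; ⊥-elim)
open import Data.Fin using (Fin; zero; suc; toℕ)
open import Data.Fin.Patterns using (0F; 1F; 2F)
open import Data.Fin.Properties using (all?; _≟_) renaming (any? to any?ᶠ)
open import Data.List using (List; []; _∷_; length; lookup; filter; reverse)
open import Data.List.Properties using (unfold-reverse; length-reverse; length-filter)
open import Data.List.Membership.Propositional using (_∈_; find; lose)
open import Data.List.Membership.Propositional.Properties using (∈-lookup; ∈-filter⁻)
open import Data.List.Relation.Unary.Any using (here; there; any?)
open import Data.List.Relation.Unary.All as All using (All; []; _∷_)
open import Data.List.Relation.Unary.All.Properties using (all-filter)
open import Data.List.Relation.Unary.AllPairs as AllPairs using (AllPairs; []; _∷_)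
import Data.List.Relation.Unary.AllPairs.Properties as AllPairsₚ
open import Data.List.Relation.Unary.Unique.Propositional using (Unique)
import Data.List.Relation.Unary.Unique.Propositional.Properties as Uniqueₚ
open import Data.List.Relation.Binary.Sublist.Propositional
  using (_⊆_; []; _∷_; _∷ʳ_; ⊆-trans; ⊆-refl; minimum)
open import Data.List.Relation.Binary.Sublist.Propositional.Properties
  using (filter-⊆; filter⁺; length-mono-≤; All-resp-⊆; Any-resp-⊆)
open import Data.List.Relation.Binary.Permutation.Propositional using (_↭_; ↭-sym)
open import Data.List.Relation.Binary.Permutation.Propositional.Properties
  using (↭-reverse; filter-↭; ↭-length; ∈-resp-↭; All-resp-↭)
open import Data.Nat using (ℕ; zero; suc; _+_; _*_; _≤_; _<_; z≤n; s≤s)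
open import Data.Nat.Properties
  using ( _≤?_; ≤-refl; ≤-reflexive; ≤-trans; <-≤-trans; ≤-<-trans; <⇒≤; ≰⇒>; n≤1+n; m≤n+m; m≤m+n
        ; +-comm; +-assoc; +-suc; *-suc; +-monoˡ-≤; +-monoʳ-≤; +-monoˡ-<; +-monoʳ-<; +-mono-<; *-monoʳ-≤
        ; +-cancelʳ-<; *-cancelˡ-<; module ≤-Reasoning)
open import Data.Product using (Σ; ∃; ∃₂; ∃-syntax; _×_; _,_; proj₁; proj₂; swap)
open import Data.Sum using (_⊎_; inj₁; inj₂)
open import Data.Unit using (⊤; tt)
open import Function using (id; flip; _∘_)
open import Relation.Binary.PropositionalEquality using (_≡_; _≢_; refl; sym; trans; cong; subst)
open import Relation.Nullary using (¬_; ¬?; Dec; yes; no; contradiction)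
open import Relation.Nullary.Decidable using (toWitness; _⊎-dec_; _×-dec_)
open import Relation.Unary using (Pred; Decidable)
open import Relation.Unary.Properties using (∁?; _∪?_)

module _ {ℓ} {A : Set} {P : Pred A ℓ} (P? : Decidable P) where

  length-filter-∁ : ∀ xs → length (filter P? xs) + length (filter (∁? P?) xs) ≡ length xs
  length-filter-∁ [] = refl
  length-filter-∁ (x ∷ xs) with P? x
  ... | yes _ = cong suc (length-filter-∁ xs)
  ... | no _  = trans (+-suc _ _) (cong suc (length-filter-∁ xs))

  length-filter-∁-< : ∀ xs {k} → length (filter P? xs) < k → length xs < length (filter (∁? P?) xs) + k
  length-filter-∁-< xs {k} few = begin-strict
    length xs                                          ≡⟨ sym (length-filter-∁ xs) ⟩
    length (filter P? xs) + length (filter (∁? P?) xs) ≡⟨ +-comm (length (filter P? xs)) _ ⟩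
    length (filter (∁? P?) xs) + length (filter P? xs) <⟨ +-monoʳ-< (length (filter (∁? P?) xs)) few ⟩
    length (filter (∁? P?) xs) + k                     ∎
    where open ≤-Reasoning

  length-filter-mono : ∀ {xs ys} → xs ⊆ ys → length (filter P? xs) ≤ length (filter P? ys)
  length-filter-mono τ = length-mono-≤ (filter⁺ P? P? (λ { refl → id }) τ)

  module _ {Q : Pred A ℓ} (Q? : Decidable Q) where

    length-filter-∪ : ∀ xs → length (filter (P? ∪? Q?) xs) ≤ length (filter P? xs) + length (filter Q? xs)
    length-filter-∪ [] = z≤n
    length-filter-∪ (x ∷ xs) with P? x | Q? x
    ... | yes _ | yes _ = s≤s (≤-trans (length-filter-∪ xs) (+-monoʳ-≤ (length (filter P? xs)) (n≤1+n _)))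
    ... | yes _ | no _  = s≤s (length-filter-∪ xs)
    ... | no _  | yes _ = ≤-trans (s≤s (length-filter-∪ xs)) (≤-reflexive (sym (+-suc _ _)))
    ... | no _  | no _  = length-filter-∪ xs

module _ {ℓ} {A B : Set} {R : B → A → Set ℓ} (R? : ∀ z → Decidable (R z)) where

  ∃-unrelated-to-all : ∀ {k} zs xs → (∀ {z} → z ∈ zs → length (filter (R? z) xs) < k) →
                       length zs * k < length xs → ∃[ x ] x ∈ xs × All (λ z → ¬ R z x) zs
  ∃-unrelated-to-all [] (x ∷ _) _ _ = x , here refl , []
  ∃-unrelated-to-all {k} (z ∷ zs) xs few long =
    let x , x∈ys , unrelated = ∃-unrelated-to-all zs ys few′ long′
        x∈xs , ¬Rzx = ∈-filter⁻ (∁? (R? z)) x∈ys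
    in  x , x∈xs , ¬Rzx ∷ unrelated
    where
    ys : List A
    ys = filter (∁? (R? z)) xs
    few′ : ∀ {z′} → z′ ∈ zs → length (filter (R? z′) ys) < k
    few′ z′∈zs = ≤-<-trans (length-filter-mono (R? _) (filter-⊆ (∁? (R? z)) xs)) (few (there z′∈zs))
    long′ : length zs * k < length ys
    long′ = +-cancelʳ-< k _ _ (begin-strict
      length zs * k + k ≡⟨ +-comm (length zs * k) k ⟩
      k + length zs * k <⟨ long ⟩
      length xs         <⟨ length-filter-∁-< (R? z) xs (few (here refl)) ⟩
      length ys + k     ∎)
      where open ≤-Reasoning

module _ {ℓ} {A : Set} {S : A → A → Set ℓ} where

  AllPairs-⊆ : ∀ {xs ys} → xs ⊆ ys → AllPairs S ys → AllPairs S xs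
  AllPairs-⊆ []         []         = []
  AllPairs-⊆ (_ ∷ʳ τ)   (_ ∷ pys)  = AllPairs-⊆ τ pys
  AllPairs-⊆ (refl ∷ τ) (py ∷ pys) = All-resp-⊆ τ py ∷ AllPairs-⊆ τ pys

  AllPairs-reverse : ∀ {xs} → AllPairs S xs → AllPairs (flip S) (reverse xs)
  AllPairs-reverse {[]}     []         = []
  AllPairs-reverse {x ∷ xs} (px ∷ pxs) rewrite unfold-reverse x xs =
    AllPairsₚ.++⁺ (AllPairs-reverse pxs) ([] ∷ [])
                  (All.map (_∷ []) (All-resp-↭ (↭-sym (↭-reverse xs)) px))

  AllPairs⇒family : (∀ {u v} → S u v → S v u) → ∀ {k xs} → AllPairs S xs → k ≤ length xs →
    Σ (Fin k → A) λ f → (∀ i → f i ∈ xs) × (∀ i j → i ≢ j → S (f i) (f j))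
  AllPairs⇒family _   {zero}  _ _ = (λ ()) , (λ ()) , λ ()
  AllPairs⇒family sym {suc k} {x ∷ xs} (px ∷ pxs) (s≤s k≤) = f , f∈ , fS
    where
    family : Σ (Fin k → A) λ f → (∀ i → f i ∈ xs) × (∀ i j → i ≢ j → S (f i) (f j))
    family = AllPairs⇒family sym pxs k≤
    f : Fin (suc k) → A
    f zero    = x
    f (suc i) = proj₁ family i
    f∈ : ∀ i → f i ∈ x ∷ xs
    f∈ zero    = here refl
    f∈ (suc i) = there (proj₁ (proj₂ family) i)
    fS : ∀ i j → i ≢ j → S (f i) (f j)
    fS zero    zero    0≢0 = contradiction refl 0≢0
    fS zero    (suc j) _   = All.lookup px (proj₁ (proj₂ family) j)
    fS (suc i) zero    _   = sym (All.lookup px (proj₁ (proj₂ family) i))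
    fS (suc i) (suc j) i≢j = proj₂ (proj₂ family) i j (i≢j ∘ cong suc)

module Greedy {ℓ} {A : Set} {R : A → A → Set ℓ} (R? : ∀ u → Decidable (R u)) where

  Sparse : ℕ → List A → Set
  Sparse b xs = ∀ {v} → v ∈ xs → length (filter (R? v) xs) < b

  Sparse-⊆ : ∀ {b xs ys} → xs ⊆ ys → Sparse b ys → Sparse b xs
  Sparse-⊆ τ sparse v∈xs = ≤-<-trans (length-filter-mono (R? _) τ) (sparse (Any-resp-⊆ τ v∈xs))

  Sparse-↭ : ∀ {b xs ys} → xs ↭ ys → Sparse b ys → Sparse b xs
  Sparse-↭ π sparse v∈xs =
    ≤-<-trans (≤-reflexive (↭-length (filter-↭ (R? _) π))) (sparse (∈-resp-↭ π v∈xs))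

  -- The fuel n only serves termination: greedy (length xs) xs is the pass over all of xs.
  greedy : ℕ → List A → List A
  greedy zero    _        = []
  greedy (suc n) []       = []
  greedy (suc n) (v ∷ xs) = v ∷ greedy n (filter (∁? (R? v)) xs)

  greedy-⊆ : ∀ n xs → greedy n xs ⊆ xs
  greedy-⊆ zero    xs       = minimum xs
  greedy-⊆ (suc n) []       = []
  greedy-⊆ (suc n) (v ∷ xs) = refl ∷ ⊆-trans (greedy-⊆ n _) (filter-⊆ (∁? (R? v)) xs)

  greedy-unrelated : ∀ n xs → AllPairs (λ u v → ¬ R u v) (greedy n xs)
  greedy-unrelated zero    _        = []
  greedy-unrelated (suc n) []       = []
  greedy-unrelated (suc n) (v ∷ xs) =
    All-resp-⊆ (greedy-⊆ n _) (all-filter (∁? (R? v)) xs) ∷ greedy-unrelated n _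

  greedy-length : ∀ {b} n xs → length xs ≤ n → Sparse b xs → length xs ≤ b * length (greedy n xs)
  greedy-length zero    []       _          _      = z≤n
  greedy-length (suc n) []       _          _      = z≤n
  greedy-length {b} (suc n) (v ∷ xs) (s≤s |xs|≤n) sparse = begin
    suc (length xs)                             ≡⟨ cong suc (sym (length-filter-∁ (R? v) xs)) ⟩
    suc (length (filter (R? v) xs)) + length ys ≤⟨ +-monoˡ-≤ (length ys) few ⟩
    b + length ys                               ≤⟨ +-monoʳ-≤ b (greedy-length n ys |ys|≤n sparse′) ⟩
    b + b * length (greedy n ys)                ≡⟨ sym (*-suc b _) ⟩
    b * length (greedy (suc n) (v ∷ xs))        ∎
    where
    open ≤-Reasoning
    ys : List A
    ys = filter (∁? (R? v)) xs
    few : suc (length (filter (R? v) xs)) ≤ b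
    few = ≤-<-trans (length-filter-mono (R? v) (v ∷ʳ ⊆-refl)) (sparse (here refl))
    |ys|≤n : length ys ≤ n
    |ys|≤n = ≤-trans (length-filter (∁? (R? v)) xs) |xs|≤n
    sparse′ : Sparse b ys
    sparse′ = Sparse-⊆ (v ∷ʳ filter-⊆ (∁? (R? v)) xs) sparse

  -- A greedy pass makes earlier elements unrelated to later ones; a second pass over the
  -- reversed result adds the converse.
  ∃-mutually-unrelated : ∀ {b k} xs → Sparse b xs → b * (b * k) < length xs →
    ∃[ zs ] (∀ {z} → z ∈ zs → z ∈ xs) × AllPairs (λ u v → ¬ R u v × ¬ R v u) zs × k < length zs
  ∃-mutually-unrelated {b} {k} xs sparse long =
    zs , zs⊆xs , unrelated , *-cancelˡ-< b _ _ (*-cancelˡ-< b _ _ (<-≤-trans long |xs|≤))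
    where
    ys ys′ zs : List A
    ys  = greedy (length xs) xs
    ys′ = reverse ys
    zs  = greedy (length ys′) ys′
    zs⊆xs : ∀ {z} → z ∈ zs → z ∈ xs
    zs⊆xs = Any-resp-⊆ (greedy-⊆ _ xs) ∘ ∈-resp-↭ (↭-reverse ys) ∘ Any-resp-⊆ (greedy-⊆ _ ys′)
    unrelated : AllPairs (λ u v → ¬ R u v × ¬ R v u) zs
    unrelated = AllPairs.zip ( greedy-unrelated _ ys′
                             , AllPairs-⊆ (greedy-⊆ _ ys′) (AllPairs-reverse (greedy-unrelated (length xs) xs)))
    |xs|≤ : length xs ≤ b * (b * length zs)
    |xs|≤ = begin
      length xs      ≤⟨ greedy-length _ xs ≤-refl sparse ⟩
      b * length ys  ≡⟨ cong (b *_) (sym (length-reverse ys)) ⟩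
      b * length ys′ ≤⟨ *-monoʳ-≤ b (greedy-length _ ys′ ≤-refl sparse′) ⟩
      b * (b * length zs) ∎
      where
      open ≤-Reasoning
      sparse′ : Sparse b ys′
      sparse′ = Sparse-↭ (↭-reverse ys) (Sparse-⊆ (greedy-⊆ _ xs) sparse)

TwinFree : Graph → Set
TwinFree H = ∀ i j → (∀ k → adj H i k ≡ adj H j k) → i ≡ j

induced-sub : ∀ {H G} → TwinFree H → (φ : V H → V G) → (∀ i j → adj G (φ i) (φ j) ≡ adj H i j) →
              InducedSub H G
induced-sub {H} {G} twin-free φ pres = record { φ = φ ; inj = φ-injective ; pres = pres }
  where
  φ-injective : ∀ i j → φ i ≡ φ j → i ≡ j
  φ-injective i j φi≡φj = twin-free i j λ k →
    trans (sym (pres i k)) (trans (cong (λ v → adj G v (φ k)) φi≡φj) (pres j k))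

P6-neighbourhoods-differ : ∀ i j → i ≡ j ⊎ ∃[ k ] adj P6 i k ≢ adj P6 j k
P6-neighbourhoods-differ =
  toWitness {a? = all? λ i → all? λ j → (i ≟ j) ⊎-dec any?ᶠ λ k → ¬? (adj P6 i k ≟ᵇ adj P6 j k)} _

P6-twin-free : TwinFree P6
P6-twin-free i j same with P6-neighbourhoods-differ i j
... | inj₁ i≡j          = i≡j
... | inj₂ (k , differ) = contradiction (same k) differ

choose : ∀ {ℓ n} {P : Fin n → Set ℓ} → Decidable P → Fin n → Fin n
choose P? default with any?ᶠ P?
... | yes (x , _) = x
... | no _        = default

choose-spec : ∀ {ℓ n} {P : Fin n → Set ℓ} (P? : Decidable P) default → ∃ P → P (choose P? default)
choose-spec P? _ ∃P with any?ᶠ P?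
... | yes (_ , Px) = Px
... | no ¬∃P       = contradiction ∃P ¬∃P

≢-preserving⇒injective : ∀ {n} {B : Set} (f : Fin n → B) → (∀ i j → i ≢ j → f i ≢ f j) →
                         ∀ i j → f i ≡ f j → i ≡ j
≢-preserving⇒injective f preserving i j fi≡fj with i ≟ j
... | yes i≡j = i≡j
... | no i≢j  = contradiction fi≡fj (preserving i j i≢j)

-- t³ for the greedy selection of the xᵢ, 3t for a vertex of X missing three given vertices.
apex-threshold : ℕ → ℕ
apex-threshold t = suc (t * (t * t) + 3 * t)

-- b² · 2 for selecting three vertices, b for discarding the neighbours of c₁ and c₂.
separator-threshold : ℕ → ℕ
separator-threshold t = let b = apex-threshold t + apex-threshold t in suc (b * (b * 2) + b)

module _ (G : Graph) where

  infix 4 _~_ _≁_ _~?_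

  _~_ : V G → V G → Set
  u ~ v = adj G u v ≡ true

  _≁_ : V G → V G → Set
  u ≁ v = adj G u v ≡ false

  _~?_ : ∀ u → Decidable (u ~_)
  u ~? v = adj G u v ≟ᵇ true

  ~-sym : ∀ {u v} → u ~ v → v ~ u
  ~-sym {u} {v} = trans (Graph.sym G v u)

  ≁-sym : ∀ {u v} → u ≁ v → v ≁ u
  ≁-sym {u} {v} = trans (Graph.sym G v u)

  ~⇒≢ : ∀ {u v} → u ~ v → u ≢ v
  ~⇒≢ u~u refl = not-¬ u~u (irrefl G _)

  ¬~⇒≁ : ∀ {u v} → ¬ u ~ v → u ≁ v
  ¬~⇒≁ = ¬-not

  ¬≁⇒~ : ∀ {u v} → ¬ u ≁ v → u ~ v
  ¬≁⇒~ = ¬-not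

  Independent : List (V G) → Set
  Independent xs = ∀ {u v} → u ∈ xs → v ∈ xs → u ≁ v

  Independent-⊆ : ∀ {xs ys} → xs ⊆ ys → Independent ys → Independent xs
  Independent-⊆ xs⊆ys independent u∈xs v∈xs =
    independent (Any-resp-⊆ xs⊆ys u∈xs) (Any-resp-⊆ xs⊆ys v∈xs)

  InducedPath : List (V G) → Set
  InducedPath []           = ⊤
  InducedPath (_ ∷ [])     = ⊤
  InducedPath (u ∷ v ∷ ws) = u ~ v × All (u ≁_) ws × InducedPath (v ∷ ws)

  -- p6adj is adjacency in the infinite path on ℕ, so it describes induced paths of any length.
  InducedPath-adj₀ : ∀ {u vs} → InducedPath (u ∷ vs) → ∀ j →
                     adj G u (lookup (u ∷ vs) j) ≡ p6adj 0 (toℕ j)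
  InducedPath-adj₀ {u} _                      zero          = irrefl G u
  InducedPath-adj₀ {vs = _ ∷ _} (u~v , _ , _)  (suc zero)    = u~v
  InducedPath-adj₀ {vs = _ ∷ _} (_ , u≁ws , _) (suc (suc j)) = All.lookup u≁ws (∈-lookup j)

  InducedPath-adj : ∀ {vs} → InducedPath vs → ∀ i j →
                    adj G (lookup vs i) (lookup vs j) ≡ p6adj (toℕ i) (toℕ j)
  InducedPath-adj {_ ∷ _}     path           zero    j       = InducedPath-adj₀ path j
  InducedPath-adj {u ∷ _}     path           (suc i) zero    =
    trans (Graph.sym G _ u) (trans (InducedPath-adj₀ path (suc i)) (p6sym 0 (suc (toℕ i))))
  InducedPath-adj {_ ∷ _ ∷ _} (_ , _ , path) (suc i) (suc j) = InducedPath-adj path i j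

  no-induced-P6 : G ∈Free P6 → ∀ {v₀ v₁ v₂ v₃ v₄ v₅} → ¬ InducedPath (v₀ ∷ v₁ ∷ v₂ ∷ v₃ ∷ v₄ ∷ v₅ ∷ [])
  no-induced-P6 P6-free {v₀} {v₁} {v₂} {v₃} {v₄} {v₅} path =
    P6-free (induced-sub P6-twin-free (lookup (v₀ ∷ v₁ ∷ v₂ ∷ v₃ ∷ v₄ ∷ v₅ ∷ [])) (InducedPath-adj path))

  K2-free⇒few-common-neighbours : ∀ {t} → G ∈Free K2 t → ∀ {u v} → u ≢ v → u ≁ v →
    ∀ {xs} → Unique xs → Independent xs → All (u ~_) xs → All (v ~_) xs → length xs < t
  K2-free⇒few-common-neighbours {t} K2-free {u} {v} u≢v u≁v {xs} unique independent u~xs v~xs =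
    ≰⇒> λ t≤|xs| → K2-free (K2-embedding t≤|xs|)
    where
    K2-embedding : t ≤ length xs → InducedSub (K2 t) G
    K2-embedding t≤|xs| = record { φ = φ ; inj = φ-injective ; pres = pres }
      where
      family : Σ (Fin t → V G) λ m → (∀ i → m i ∈ xs) × (∀ i j → i ≢ j → m i ≢ m j)
      family = AllPairs⇒family (λ x≢y → x≢y ∘ sym) unique t≤|xs|
      m : Fin t → V G
      m = proj₁ family
      m∈xs : ∀ i → m i ∈ xs
      m∈xs = proj₁ (proj₂ family)
      m-injective : ∀ i j → m i ≡ m j → i ≡ j
      m-injective = ≢-preserving⇒injective m (proj₂ (proj₂ family))
      φ : Fin (2 + t) → V G
      φ zero          = u
      φ (suc zero)    = v
      φ (suc (suc i)) = m i
      pres : ∀ i j → adj G (φ i) (φ j) ≡ adj (K2 t) i j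
      pres zero          zero          = irrefl G u
      pres zero          (suc zero)    = u≁v
      pres zero          (suc (suc j)) = All.lookup u~xs (m∈xs j)
      pres (suc zero)    zero          = ≁-sym u≁v
      pres (suc zero)    (suc zero)    = irrefl G v
      pres (suc zero)    (suc (suc j)) = All.lookup v~xs (m∈xs j)
      pres (suc (suc i)) zero          = ~-sym (All.lookup u~xs (m∈xs i))
      pres (suc (suc i)) (suc zero)    = ~-sym (All.lookup v~xs (m∈xs i))
      pres (suc (suc i)) (suc (suc j)) = independent (m∈xs i) (m∈xs j)
      φ-injective : ∀ i j → φ i ≡ φ j → i ≡ j
      φ-injective zero          zero          _    = refl
      φ-injective zero          (suc zero)    u≡v  = contradiction u≡v u≢v
      φ-injective zero          (suc (suc j)) u≡mj = contradiction u≡mj (~⇒≢ (All.lookup u~xs (m∈xs j)))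
      φ-injective (suc zero)    zero          v≡u  = contradiction (sym v≡u) u≢v
      φ-injective (suc zero)    (suc zero)    _    = refl
      φ-injective (suc zero)    (suc (suc j)) v≡mj = contradiction v≡mj (~⇒≢ (All.lookup v~xs (m∈xs j)))
      φ-injective (suc (suc i)) zero          mi≡u = contradiction (sym mi≡u) (~⇒≢ (All.lookup u~xs (m∈xs i)))
      φ-injective (suc (suc i)) (suc zero)    mi≡v = contradiction (sym mi≡v) (~⇒≢ (All.lookup v~xs (m∈xs i)))
      φ-injective (suc (suc i)) (suc (suc j)) mi≡mj = cong (λ k → suc (suc k)) (m-injective i j mi≡mj)

  walk-start : ∀ {P u v} → WalkIn G P u v → P u
  walk-start (here Pu)     = Pu
  walk-start (step Pu _ _) = Pu

  walk-end : ∀ {P u v} → WalkIn G P u v → P v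
  walk-end (here Pv)    = Pv
  walk-end (step _ _ W) = walk-end W

  first-crossing : ∀ {P : V G → Set} (f : V G → Bool) {u v} → WalkIn G P u v → f u ≡ false → f v ≡ true →
    ∃₂ λ p q → WalkIn G (λ w → P w × f w ≡ false) u p × p ~ q × P q × f q ≡ true
  first-crossing f (here _) fu≡false fu≡true = contradiction fu≡false (not-¬ fu≡true)
  first-crossing f (step {w = w} Pu u~w W) fu≡false fv≡true with f w in fw
  ... | true  = _ , w , here (Pu , fu≡false) , u~w , walk-start W , fw
  ... | false =
    let p , q , W′ , p~q , Pq , fq = first-crossing f W fw fv≡true
    in  p , q , step (Pu , fu≡false) u~w W′ , p~q , Pq , fq

  Disjoint : VSet G → VSet G → Set
  Disjoint C D = ∀ v → v ∈ᵥ C → v ∉ᵥ D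

  separated-by : (A : VSet G) → ∀ {u w} → u ∈ᵥ A → w ∉ᵥ A → u ≢ w
  separated-by A u∈A w∉A refl = not-¬ u∈A w∉A

  Disjoint-sym : ∀ {C D} → Disjoint C D → Disjoint D C
  Disjoint-sym disjoint v v∈D = ¬-not λ v∈C → not-¬ v∈D (disjoint v v∈C)

  module _ {S C : VSet G} (C-component : IsComponent G S C) where

    component-∉ᵥ : ∀ {v} → v ∈ᵥ C → v ∉ᵥ S
    component-∉ᵥ = proj₁ (proj₂ C-component) _

    component-walk : ∀ {u v} → u ∈ᵥ C → v ∈ᵥ C → WalkIn G (_∈ᵥ C) u v
    component-walk = proj₁ (proj₂ (proj₂ C-component)) _ _

    component-closed : ∀ {u w} → u ∈ᵥ C → w ∉ᵥ S → u ~ w → w ∈ᵥ C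
    component-closed = proj₂ (proj₂ (proj₂ C-component)) _ _

    walk-stays-in-component : ∀ {P u v} → (∀ {w} → P w → w ∉ᵥ S) → WalkIn G P u v → u ∈ᵥ C → v ∈ᵥ C
    walk-stays-in-component P∩S=∅ (here _)       u∈C = u∈C
    walk-stays-in-component P∩S=∅ (step _ u~w W) u∈C =
      walk-stays-in-component P∩S=∅ W (component-closed u∈C (P∩S=∅ (walk-start W)) u~w)

  module _ {S C D : VSet G} (C-component : IsComponent G S C) (D-component : IsComponent G S D) where

    components-disjoint : (∃[ v ] v ∈ᵥ C × v ∉ᵥ D) → Disjoint C D
    components-disjoint (v , v∈C , v∉D) w w∈C = ¬-not λ w∈D →
      not-¬ (walk-stays-in-component D-component (component-∉ᵥ C-component)
                                     (component-walk C-component w∈C v∈C) w∈D) v∉D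

    components-anticomplete : Disjoint C D → ∀ {u w} → u ∈ᵥ C → w ∈ᵥ D → u ≁ w
    components-anticomplete disjoint u∈C w∈D = ¬~⇒≁ λ u~w →
      not-¬ w∈D (disjoint _ (component-closed C-component u∈C (component-∉ᵥ D-component w∈D) u~w))

  InducedTail : V G → List (V G) → Set
  InducedTail s ws = ∃₂ λ u r → u ~ r × r ~ s × u ≁ s × All (u ≁_) ws × All (r ≁_) ws

  -- Let q be the first neighbour of s on the walk. If c ≁ q, the first neighbour q′ of q on the walk,
  -- with its predecessor p′, gives an induced path s – q – q′ – p′ in P, which the tail extends to a P₆.
  ∃-common-neighbour : G ∈Free P6 → ∀ {P s c w} → WalkIn G P c w → s ≁ c → s ~ w →
    (∀ {q q′ p} → P q → P q′ → P p → InducedTail s (q ∷ q′ ∷ p ∷ [])) →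
    ∃[ y ] P y × s ~ y × c ~ y
  ∃-common-neighbour P6-free {s = s} {c} walk s≁c s~w tail
    with first-crossing (adj G s) walk s≁c s~w
  ... | p , q , prefix , p~q , Pq , s~q with adj G c q in c?q
  ...   | true  = q , Pq , s~q , c?q
  ...   | false with first-crossing (adj G q) prefix (≁-sym c?q) (~-sym p~q)
  ...     | p′ , q′ , prefix′ , p′~q′ , (Pq′ , s≁q′) , q~q′ =
    let (Pp′ , s≁p′) , q≁p′ = walk-end prefix′
        u , r , u~r , r~s , u≁s , u≁qq′p′ , r≁qq′p′ = tail Pq Pq′ Pp′
    in  contradiction
          ( u~r , u≁s ∷ u≁qq′p′
          , r~s , r≁qq′p′
          , s~q , s≁q′ ∷ s≁p′ ∷ []
          , q~q′ , q≁p′ ∷ []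
          , ~-sym p′~q′ , [] , tt)
          (no-induced-P6 P6-free)

  InducedTail-from-full-component : ∀ {S C D} → IsFullComponent G S D →
    (∀ {u w} → u ∈ᵥ D → w ∈ᵥ C → u ≁ w) →
    ∀ {s c} → s ∈ᵥ S → c ∈ᵥ D → s ≁ c → ∀ {ws} → All (_∈ᵥ C) ws → InducedTail s ws
  InducedTail-from-full-component (D-component , _ , S⊆N[D]) D-C-anticomplete s∈S c∈D s≁c ws⊆C =
    let _ , w , w∈D , w~s = S⊆N[D] _ s∈S
        p , q , prefix , p~q , q∈D , s~q =
          first-crossing (adj G _) (component-walk D-component c∈D w∈D) s≁c (~-sym w~s)
        p∈D , s≁p = walk-end prefix
    in  p , q , p~q , ~-sym s~q , ≁-sym s≁p
      , All.map (D-C-anticomplete p∈D) ws⊆C , All.map (D-C-anticomplete q∈D) ws⊆C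

  CommonNeighbourIn : VSet G → V G → V G → V G → Set
  CommonNeighbourIn C c s y = y ∈ᵥ C × s ~ y × c ~ y

  -- s itself is returned when there is no such common neighbour.
  link : VSet G → V G → V G → V G
  link C c s = choose (λ y → (C y ≟ᵇ true) ×-dec (s ~? y) ×-dec (c ~? y)) s

  link-spec : ∀ {C c s} → ∃ (CommonNeighbourIn C c s) → CommonNeighbourIn C c s (link C c s)
  link-spec = choose-spec _ _

  ∃-common-neighbour-in-full-component : G ∈Free P6 → ∀ {S C D} →
    IsFullComponent G S C → IsFullComponent G S D → (∀ {u w} → u ∈ᵥ D → w ∈ᵥ C → u ≁ w) →
    ∀ {s c d} → s ∈ᵥ S → c ∈ᵥ C → d ∈ᵥ D → s ≁ c → s ≁ d → ∃ (CommonNeighbourIn C c s)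
  ∃-common-neighbour-in-full-component P6-free (C-component , _ , S⊆N[C]) D-full D-C-anticomplete
                                       s∈S c∈C d∈D s≁c s≁d =
    let _ , w , w∈C , w~s = S⊆N[C] _ s∈S
    in  ∃-common-neighbour P6-free (component-walk C-component c∈C w∈C) s≁c (~-sym w~s) λ q∈C q′∈C p∈C →
          InducedTail-from-full-component D-full D-C-anticomplete s∈S d∈D s≁d (q∈C ∷ q′∈C ∷ p∈C ∷ [])

  links-adjacent : G ∈Free P6 → ∀ {C D c s s′ y y′ z′} → (∀ {u w} → u ∈ᵥ C → w ∈ᵥ D → u ≁ w) →
    c ∈ᵥ C → CommonNeighbourIn C c s y → CommonNeighbourIn C c s′ y′ → z′ ∈ᵥ D → s′ ~ z′ →
    s ≁ c → s′ ≁ c → s ≁ s′ → y ≁ s′ → y′ ≁ s → z′ ≁ s → y ~ y′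
  links-adjacent P6-free C-D-anticomplete c∈C (y∈C , s~y , c~y) (y′∈C , s′~y′ , c~y′) z′∈D s′~z′
                 s≁c s′≁c s≁s′ y≁s′ y′≁s z′≁s = ¬≁⇒~ λ y≁y′ → no-induced-P6 P6-free
    ( s~y , s≁c ∷ ≁-sym y′≁s ∷ s≁s′ ∷ ≁-sym z′≁s ∷ []
    , ~-sym c~y , y≁y′ ∷ y≁s′ ∷ C-D-anticomplete y∈C z′∈D ∷ []
    , c~y′ , ≁-sym s′≁c ∷ C-D-anticomplete c∈C z′∈D ∷ []
    , ~-sym s′~y′ , C-D-anticomplete y′∈C z′∈D ∷ []
    , s′~z′ , [] , tt)

  module Apex (P6-free : G ∈Free P6) {t} (K2-free : G ∈Free K2 t) {S CA CB : VSet G}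
    (CA-component : IsComponent G S CA) (CB-full : IsFullComponent G S CB) (disjoint : Disjoint CA CB)
    {a} (a∈CA : a ∈ᵥ CA) {L} (L-unique : Unique L) (L⊆S : ∀ {x} → x ∈ L → x ∈ᵥ S)
    (L-independent : Independent L) (many : apex-threshold t ≤ length (filter (a ~?_) L)) where

    CB-component : IsComponent G S CB
    CB-component = proj₁ CB-full

    CA-CB-anticomplete : ∀ {u w} → u ∈ᵥ CA → w ∈ᵥ CB → u ≁ w
    CA-CB-anticomplete = components-anticomplete CA-component CB-component disjoint

    X : List (V G)
    X = filter (a ~?_) L

    X⊆L : ∀ {x} → x ∈ X → x ∈ L
    X⊆L = proj₁ ∘ ∈-filter⁻ (a ~?_)

    X-independent : Independent X
    X-independent = Independent-⊆ (filter-⊆ (a ~?_) L) L-independent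

    a~X : All (a ~_) X
    a~X = all-filter (a ~?_) L

    X-unique : Unique X
    X-unique = Uniqueₚ.filter⁺ (a ~?_) L-unique

    few-neighbours : ∀ {z} → z ∈ᵥ CB → length (filter (z ~?_) X) < t
    few-neighbours {z} z∈CB =
      K2-free⇒few-common-neighbours K2-free {a} {z} (separated-by CA a∈CA (Disjoint-sym disjoint z z∈CB))
        (CA-CB-anticomplete a∈CA z∈CB) (Uniqueₚ.filter⁺ (z ~?_) X-unique)
        (Independent-⊆ (filter-⊆ (z ~?_) X) X-independent) (All-resp-⊆ (filter-⊆ (z ~?_) X) a~X)
        (all-filter (z ~?_) X)

    3t<|X| : 3 * t < length X
    3t<|X| = <-≤-trans (s≤s (m≤n+m (3 * t) (t * (t * t)))) many

    ∃-non-neighbour : ∀ {zs} → All (_∈ᵥ CB) zs → length zs * t < length X → ∃[ x ] x ∈ X × All (x ≁_) zs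
    ∃-non-neighbour zs⊆CB long =
      let x , x∈X , unrelated = ∃-unrelated-to-all _~?_ _ X (few-neighbours ∘ All.lookup zs⊆CB) long
      in  x , x∈X , All.map (≁-sym ∘ ¬~⇒≁) unrelated

    induced-tail : ∀ {x} → x ∈ X → ∀ {q q′ p} → q ∈ᵥ CB → q′ ∈ᵥ CB → p ∈ᵥ CB →
                   InducedTail x (q ∷ q′ ∷ p ∷ [])
    induced-tail x∈X q∈CB q′∈CB p∈CB =
      let qq′p⊆CB = q∈CB ∷ q′∈CB ∷ p∈CB ∷ []
          x′ , x′∈X , x′≁qq′p = ∃-non-neighbour qq′p⊆CB 3t<|X|
      in  x′ , a , ~-sym (All.lookup a~X x′∈X) , All.lookup a~X x∈X , X-independent x′∈X x∈X
        , x′≁qq′p , All.map (CA-CB-anticomplete a∈CA) qq′p⊆CB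

    c₀ : V G
    c₀ = proj₁ (proj₁ CB-component)

    c₀∈CB : c₀ ∈ᵥ CB
    c₀∈CB = proj₂ (proj₁ CB-component)

    X₀ : List (V G)
    X₀ = filter (∁? (c₀ ~?_)) X

    X₀-spec : ∀ {x} → x ∈ X₀ → x ∈ X × ¬ c₀ ~ x
    X₀-spec = ∈-filter⁻ (∁? (c₀ ~?_)) {xs = X}

    y : V G → V G
    y = link CB c₀

    y-spec : ∀ {x} → x ∈ X₀ → CommonNeighbourIn CB c₀ x (y x)
    y-spec x∈X₀ =
      let x∈X , c₀≁x = X₀-spec x∈X₀
          _ , w , w∈CB , w~x = proj₂ (proj₂ CB-full) _ (L⊆S (X⊆L x∈X))
      in  link-spec (∃-common-neighbour P6-free (component-walk CB-component c₀∈CB w∈CB)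
                                        (≁-sym (¬~⇒≁ c₀≁x)) (~-sym w~x) (induced-tail x∈X))

    open Greedy (λ x → y x ~?_)

    sparse : Sparse t X₀
    sparse {x} x∈X₀ =
      ≤-<-trans (length-filter-mono (y x ~?_) (filter-⊆ _ X)) (few-neighbours (proj₁ (y-spec x∈X₀)))

    long : t * (t * t) < length X₀
    long = +-cancelʳ-< t _ _ (begin-strict
      t * (t * t) + t     ≤⟨ +-monoʳ-≤ (t * (t * t)) (m≤m+n t _) ⟩
      t * (t * t) + 3 * t <⟨ many ⟩
      length X            <⟨ length-filter-∁-< (c₀ ~?_) X (few-neighbours c₀∈CB) ⟩
      length X₀ + t       ∎)
      where open ≤-Reasoning

    module _ (x : Fin t → V G) (x∈X₀ : ∀ i → x i ∈ X₀)
             (unrelated : ∀ i j → i ≢ j → ¬ y (x i) ~ x j × ¬ y (x j) ~ x i) where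

      x∈X : ∀ i → x i ∈ X
      x∈X i = proj₁ (X₀-spec (x∈X₀ i))

      x∈S : ∀ i → x i ∈ᵥ S
      x∈S i = L⊆S (X⊆L (x∈X i))

      y∈CB : ∀ i → y (x i) ∈ᵥ CB
      y∈CB i = proj₁ (y-spec (x∈X₀ i))

      x~y : ∀ i → x i ~ y (x i)
      x~y i = proj₁ (proj₂ (y-spec (x∈X₀ i)))

      c₀~y : ∀ i → c₀ ~ y (x i)
      c₀~y i = proj₂ (proj₂ (y-spec (x∈X₀ i)))

      y-adjacent : ∀ i j → i ≢ j → y (x i) ~ y (x j)
      y-adjacent i j i≢j = ¬≁⇒~ (induced-P6 (∃-non-neighbour (y∈CB i ∷ y∈CB j ∷ c₀∈CB ∷ []) 3t<|X|))
        where
        induced-P6 : ∃[ x′ ] x′ ∈ X × All (x′ ≁_) (y (x i) ∷ y (x j) ∷ c₀ ∷ []) → ¬ y (x i) ≁ y (x j)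
        induced-P6 (x′ , x′∈X , x′≁yᵢ ∷ x′≁yⱼ ∷ x′≁c₀ ∷ []) yᵢ≁yⱼ = no-induced-P6 P6-free
          ( ~-sym (c₀~y i)
          , yᵢ≁yⱼ ∷ ¬~⇒≁ (proj₁ (unrelated i j i≢j)) ∷ ≁-sym (CA-CB-anticomplete a∈CA (y∈CB i))
            ∷ ≁-sym x′≁yᵢ ∷ []
          , c₀~y j
          , ¬~⇒≁ (proj₂ (X₀-spec (x∈X₀ j))) ∷ ≁-sym (CA-CB-anticomplete a∈CA c₀∈CB) ∷ ≁-sym x′≁c₀ ∷ []
          , ~-sym (x~y j)
          , ≁-sym (CA-CB-anticomplete a∈CA (y∈CB j)) ∷ ≁-sym x′≁yⱼ ∷ []
          , ~-sym (All.lookup a~X (x∈X j))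
          , X-independent (x∈X j) x′∈X ∷ []
          , All.lookup a~X x′∈X
          , [] , tt)

      x-distinct : ∀ i j → i ≢ j → x i ≢ x j
      x-distinct i j i≢j xi≡xj = proj₁ (unrelated i j i≢j) (subst (y (x i) ~_) xi≡xj (~-sym (x~y i)))

      y-distinct : ∀ i j → i ≢ j → y (x i) ≢ y (x j)
      y-distinct i j i≢j yᵢ≡yⱼ =
        proj₁ (unrelated i j i≢j) (subst (_~ x j) (sym yᵢ≡yⱼ) (~-sym (x~y j)))

      pyramid : InducedPyramid G t a x (y ∘ x)
      pyramid = record
        { a≢x  = λ i → separated-by S (x∈S i) (component-∉ᵥ CA-component a∈CA) ∘ sym
        ; a≢y  = λ i → separated-by CA a∈CA (Disjoint-sym disjoint _ (y∈CB i))
        ; x≢y  = λ i j → separated-by S (x∈S i) (component-∉ᵥ CB-component (y∈CB j))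
        ; x-inj = ≢-preserving⇒injective x x-distinct
        ; y-inj = ≢-preserving⇒injective (y ∘ x) y-distinct
        ; a-x  = λ i → All.lookup a~X (x∈X i)
        ; a-y  = λ i → CA-CB-anticomplete a∈CA (y∈CB i)
        ; x-x  = λ i j _ → X-independent (x∈X i) (x∈X j)
        ; x-y≡ = x~y
        ; x-y≢ = λ i j i≢j → ≁-sym (¬~⇒≁ (proj₂ (unrelated i j i≢j)))
        ; y-y  = y-adjacent
        }

    ∃-pyramid : Σ (Fin t → V G) λ x → Σ (Fin t → V G) λ y → InducedPyramid G t a x y ×
      (a ∉ᵥ S) × (∀ i → x i ∈ᵥ S) × (∀ i → y i ∉ᵥ S) × (∀ i → y i ∈ᵥ CB)
    ∃-pyramid = from-selection (∃-mutually-unrelated X₀ sparse long)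
      where
      from-selection : ∃[ zs ] (∀ {z} → z ∈ zs → z ∈ X₀) ×
                         AllPairs (λ u v → ¬ y u ~ v × ¬ y v ~ u) zs × t < length zs →
        Σ (Fin t → V G) λ x → Σ (Fin t → V G) λ y → InducedPyramid G t a x y ×
          (a ∉ᵥ S) × (∀ i → x i ∈ᵥ S) × (∀ i → y i ∉ᵥ S) × (∀ i → y i ∈ᵥ CB)
      from-selection (zs , zs⊆X₀ , zs-unrelated , t<|zs|) =
        let x , x∈zs , unrelated = AllPairs⇒family swap zs-unrelated (<⇒≤ t<|zs|)
            x∈X₀ = zs⊆X₀ ∘ x∈zs
        in  x , y ∘ x , pyramid x x∈X₀ unrelated , component-∉ᵥ CA-component a∈CA , x∈S x x∈X₀ unrelated
          , component-∉ᵥ CB-component ∘ y∈CB x x∈X₀ unrelated , y∈CB x x∈X₀ unrelated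

  PyramidAcross : ℕ → VSet G → VSet G → VSet G → Set
  PyramidAcross t S C₁ C₂ = Σ (V G) λ a → Σ (Fin t → V G) λ x → Σ (Fin t → V G) λ y →
    InducedPyramid G t a x y ×
    (a ∉ᵥ S) × (∀ i → x i ∈ᵥ S) × (∀ i → y i ∉ᵥ S) ×
    (((a ∈ᵥ C₁) × (∀ i → y i ∈ᵥ C₂)) ⊎ ((a ∈ᵥ C₂) × (∀ i → y i ∈ᵥ C₁)))

  module Across (P6-free : G ∈Free P6) {t} (K2-free : G ∈Free K2 t) {S C₁ C₂ : VSet G}
    (C₁-full : IsFullComponent G S C₁) (C₂-full : IsFullComponent G S C₂) (disjoint : Disjoint C₁ C₂)
    {I} (I-unique : Unique I) (I⊆S : ∀ {x} → x ∈ I → x ∈ᵥ S) (I-independent : Independent I)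
    (large : separator-threshold t ≤ length I) where

    g : ℕ
    g = apex-threshold t

    C₁-component : IsComponent G S C₁
    C₁-component = proj₁ C₁-full

    C₂-component : IsComponent G S C₂
    C₂-component = proj₁ C₂-full

    C₁-C₂-anticomplete : ∀ {u w} → u ∈ᵥ C₁ → w ∈ᵥ C₂ → u ≁ w
    C₁-C₂-anticomplete = components-anticomplete C₁-component C₂-component disjoint

    C₂-C₁-anticomplete : ∀ {u w} → u ∈ᵥ C₂ → w ∈ᵥ C₁ → u ≁ w
    C₂-C₁-anticomplete = components-anticomplete C₂-component C₁-component (Disjoint-sym disjoint)

    ∃-pyramid-with-apex : ∀ {C D a L} → IsComponent G S C → IsFullComponent G S D → Disjoint C D → a ∈ᵥ C →
      L ⊆ I → g ≤ length (filter (a ~?_) L) →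
      Σ (Fin t → V G) λ x → Σ (Fin t → V G) λ y → InducedPyramid G t a x y ×
        (a ∉ᵥ S) × (∀ i → x i ∈ᵥ S) × (∀ i → y i ∉ᵥ S) × (∀ i → y i ∈ᵥ D)
    ∃-pyramid-with-apex C-component D-full C∩D=∅ a∈C L⊆I =
      Apex.∃-pyramid P6-free K2-free C-component D-full C∩D=∅ a∈C (AllPairs-⊆ L⊆I I-unique)
        (I⊆S ∘ Any-resp-⊆ L⊆I) (Independent-⊆ L⊆I I-independent)

    apex-in-C₁ : ∀ {a L} → a ∈ᵥ C₁ → L ⊆ I → g ≤ length (filter (a ~?_) L) → PyramidAcross t S C₁ C₂
    apex-in-C₁ a∈C₁ L⊆I many =
      let x , y , pyramid , a∉S , x∈S , y∉S , y∈C₂ =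
            ∃-pyramid-with-apex C₁-component C₂-full disjoint a∈C₁ L⊆I many
      in  _ , x , y , pyramid , a∉S , x∈S , y∉S , inj₁ (a∈C₁ , y∈C₂)

    apex-in-C₂ : ∀ {a L} → a ∈ᵥ C₂ → L ⊆ I → g ≤ length (filter (a ~?_) L) → PyramidAcross t S C₁ C₂
    apex-in-C₂ a∈C₂ L⊆I many =
      let x , y , pyramid , a∉S , x∈S , y∉S , y∈C₁ =
            ∃-pyramid-with-apex C₂-component C₁-full (Disjoint-sym disjoint) a∈C₂ L⊆I many
      in  _ , x , y , pyramid , a∉S , x∈S , y∉S , inj₂ (a∈C₂ , y∈C₁)

    many? : ∀ a L → Dec (g ≤ length (filter (a ~?_) L))
    many? a L = g ≤? length (filter (a ~?_) L)

    c₁ c₂ : V G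
    c₁ = proj₁ (proj₁ C₁-component)
    c₂ = proj₁ (proj₁ C₂-component)

    c₁∈C₁ : c₁ ∈ᵥ C₁
    c₁∈C₁ = proj₂ (proj₁ C₁-component)

    c₂∈C₂ : c₂ ∈ᵥ C₂
    c₂∈C₂ = proj₂ (proj₁ C₂-component)

    module NoApex (few₁ : length (filter (c₁ ~?_) I) < g) (few₂ : length (filter (c₂ ~?_) I) < g) where

      I₁ J : List (V G)
      I₁ = filter (∁? (c₁ ~?_)) I
      J  = filter (∁? (c₂ ~?_)) I₁

      J⊆I : J ⊆ I
      J⊆I = ⊆-trans (filter-⊆ _ I₁) (filter-⊆ _ I)

      J-independent : Independent J
      J-independent = Independent-⊆ J⊆I I-independent

      J∈S : ∀ {s} → s ∈ J → s ∈ᵥ S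
      J∈S = I⊆S ∘ Any-resp-⊆ J⊆I

      J≁c₁ : ∀ {s} → s ∈ J → s ≁ c₁
      J≁c₁ s∈J =
        ≁-sym (¬~⇒≁ (proj₂ (∈-filter⁻ (∁? (c₁ ~?_)) {xs = I} (proj₁ (∈-filter⁻ (∁? (c₂ ~?_)) {xs = I₁} s∈J)))))

      J≁c₂ : ∀ {s} → s ∈ J → s ≁ c₂
      J≁c₂ s∈J = ≁-sym (¬~⇒≁ (proj₂ (∈-filter⁻ (∁? (c₂ ~?_)) {xs = I₁} s∈J)))

      b : ℕ
      b = g + g

      long : b * (b * 2) < length J
      long = +-cancelʳ-< b _ _ (begin-strict
        b * (b * 2) + b <⟨ large ⟩
        length I        <⟨ length-filter-∁-< (c₁ ~?_) I few₁ ⟩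
        length I₁ + g   <⟨ +-monoˡ-< g (length-filter-∁-< (c₂ ~?_) I₁ few₂′) ⟩
        length J + g + g ≡⟨ +-assoc (length J) g g ⟩
        length J + b    ∎)
        where
        open ≤-Reasoning
        few₂′ : length (filter (c₂ ~?_) I₁) < g
        few₂′ = ≤-<-trans (length-filter-mono (c₂ ~?_) (filter-⊆ _ I)) few₂

      y₁ y₂ : V G → V G
      y₁ = link C₁ c₁
      y₂ = link C₂ c₂

      y₁-spec : ∀ {s} → s ∈ J → CommonNeighbourIn C₁ c₁ s (y₁ s)
      y₁-spec s∈J = link-spec (∃-common-neighbour-in-full-component P6-free C₁-full C₂-full
                                 C₂-C₁-anticomplete (J∈S s∈J) c₁∈C₁ c₂∈C₂ (J≁c₁ s∈J) (J≁c₂ s∈J))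

      y₂-spec : ∀ {s} → s ∈ J → CommonNeighbourIn C₂ c₂ s (y₂ s)
      y₂-spec s∈J = link-spec (∃-common-neighbour-in-full-component P6-free C₂-full C₁-full
                                 C₁-C₂-anticomplete (J∈S s∈J) c₂∈C₂ c₁∈C₁ (J≁c₂ s∈J) (J≁c₁ s∈J))

      Related : V G → V G → Set
      Related s v = y₁ s ~ v ⊎ y₂ s ~ v

      open Greedy (λ s → (y₁ s ~?_) ∪? (y₂ s ~?_))

      module _ (s : Fin 3 → V G) (s∈J : ∀ i → s i ∈ J)
               (unrelated : ∀ i j → i ≢ j → ¬ Related (s i) (s j) × ¬ Related (s j) (s i)) where

        y₁≁s : ∀ i j → i ≢ j → y₁ (s i) ≁ s j
        y₁≁s i j i≢j = ¬~⇒≁ (proj₁ (unrelated i j i≢j) ∘ inj₁)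

        y₂≁s : ∀ i j → i ≢ j → y₂ (s i) ≁ s j
        y₂≁s i j i≢j = ¬~⇒≁ (proj₁ (unrelated i j i≢j) ∘ inj₂)

        y₁∈C₁ : ∀ i → y₁ (s i) ∈ᵥ C₁
        y₁∈C₁ i = proj₁ (y₁-spec (s∈J i))

        y₂∈C₂ : ∀ i → y₂ (s i) ∈ᵥ C₂
        y₂∈C₂ i = proj₁ (y₂-spec (s∈J i))

        s~y₁ : ∀ i → s i ~ y₁ (s i)
        s~y₁ i = proj₁ (proj₂ (y₁-spec (s∈J i)))

        s~y₂ : ∀ i → s i ~ y₂ (s i)
        s~y₂ i = proj₁ (proj₂ (y₂-spec (s∈J i)))

        y₁-adjacent : y₁ (s 0F) ~ y₁ (s 1F)
        y₁-adjacent = links-adjacent P6-free C₁-C₂-anticomplete c₁∈C₁ (y₁-spec (s∈J 0F)) (y₁-spec (s∈J 1F))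
          (y₂∈C₂ 1F) (s~y₂ 1F) (J≁c₁ (s∈J 0F)) (J≁c₁ (s∈J 1F)) (J-independent (s∈J 0F) (s∈J 1F))
          (y₁≁s 0F 1F (λ ())) (y₁≁s 1F 0F (λ ())) (y₂≁s 1F 0F (λ ()))

        y₂-adjacent : y₂ (s 1F) ~ y₂ (s 2F)
        y₂-adjacent = links-adjacent P6-free C₂-C₁-anticomplete c₂∈C₂ (y₂-spec (s∈J 1F)) (y₂-spec (s∈J 2F))
          (y₁∈C₁ 2F) (s~y₁ 2F) (J≁c₂ (s∈J 1F)) (J≁c₂ (s∈J 2F)) (J-independent (s∈J 1F) (s∈J 2F))
          (y₂≁s 1F 2F (λ ())) (y₂≁s 2F 1F (λ ())) (y₁≁s 2F 1F (λ ()))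

        no-unrelated-triple : ⊥
        no-unrelated-triple = no-induced-P6 P6-free
          ( s~y₁ 0F
          , ≁-sym (y₁≁s 1F 0F (λ ())) ∷ J-independent (s∈J 0F) (s∈J 1F)
            ∷ ≁-sym (y₂≁s 1F 0F (λ ())) ∷ ≁-sym (y₂≁s 2F 0F (λ ())) ∷ []
          , y₁-adjacent
          , y₁≁s 0F 1F (λ ()) ∷ C₁-C₂-anticomplete (y₁∈C₁ 0F) (y₂∈C₂ 1F)
            ∷ C₁-C₂-anticomplete (y₁∈C₁ 0F) (y₂∈C₂ 2F) ∷ []
          , ~-sym (s~y₁ 1F)
          , C₁-C₂-anticomplete (y₁∈C₁ 1F) (y₂∈C₂ 1F) ∷ C₁-C₂-anticomplete (y₁∈C₁ 1F) (y₂∈C₂ 2F) ∷ []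
          , s~y₂ 1F
          , ≁-sym (y₂≁s 2F 1F (λ ())) ∷ []
          , y₂-adjacent , [] , tt)

      J-not-sparse : ¬ Sparse b J
      J-not-sparse sparse = from-selection (∃-mutually-unrelated J sparse long)
        where
        from-selection : ∃[ zs ] (∀ {z} → z ∈ zs → z ∈ J) ×
                           AllPairs (λ u v → ¬ Related u v × ¬ Related v u) zs × 2 < length zs → ⊥
        from-selection (zs , zs⊆J , zs-unrelated , 2<|zs|) =
          let s , s∈zs , unrelated = AllPairs⇒family swap zs-unrelated 2<|zs|
          in  no-unrelated-triple s (zs⊆J ∘ s∈zs) unrelated

      pyramid : PyramidAcross t S C₁ C₂
      pyramid with any? (λ s → many? (y₁ s) J) J
      ... | yes ∃s = let s , s∈J , many = find ∃s in apex-in-C₁ (proj₁ (y₁-spec {s} s∈J)) J⊆I many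
      ... | no none₁ with any? (λ s → many? (y₂ s) J) J
      ...   | yes ∃s = let s , s∈J , many = find ∃s in apex-in-C₂ (proj₁ (y₂-spec {s} s∈J)) J⊆I many
      ...   | no none₂ = ⊥-elim (J-not-sparse λ {s} s∈J →
        ≤-<-trans (length-filter-∪ (y₁ s ~?_) (y₂ s ~?_) J)
                  (+-mono-< (≰⇒> (none₁ ∘ lose s∈J)) (≰⇒> (none₂ ∘ lose s∈J))))

    pyramid : PyramidAcross t S C₁ C₂
    pyramid with many? c₁ I | many? c₂ I
    ... | yes many | _        = apex-in-C₁ c₁∈C₁ ⊆-refl many
    ... | no _     | yes many = apex-in-C₂ c₂∈C₂ ⊆-refl many
    ... | no few₁  | no few₂  = NoApex.pyramid (≰⇒> few₁) (≰⇒> few₂)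

lemma4p4 : Σ (ℕ → ℕ) λ f →
    (t : ℕ) → 3 ≤ t → (G : Graph) → G ∈Free P6 → G ∈Free K2 t →
    (S : VSet G) → MinimalSeparator G S → AlphaAtLeast G S (f t) →
    (C₁ C₂ : VSet G) → IsFullComponent G S C₁ → IsFullComponent G S C₂ →
    (Σ (V G) λ v → (v ∈ᵥ C₁) × (v ∉ᵥ C₂)) →
    Σ (V G) λ a → Σ (Fin t → V G) λ x → Σ (Fin t → V G) λ y →
      InducedPyramid G t a x y ×
      (a ∉ᵥ S) × (∀ i → x i ∈ᵥ S) × (∀ i → y i ∉ᵥ S) ×
      (((a ∈ᵥ C₁) × (∀ i → y i ∈ᵥ C₂)) ⊎ ((a ∈ᵥ C₂) × (∀ i → y i ∈ᵥ C₁)))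
lemma4p4 = separator-threshold ,
  λ t _ G P6-free K2-free S _ (I , I-unique , I⊆S , I-independent , large) C₁ C₂ C₁-full C₂-full C₁⊈C₂ →
    Across.pyramid G P6-free K2-free C₁-full C₂-full
      (components-disjoint G (proj₁ C₁-full) (proj₁ C₂-full) C₁⊈C₂)
      I-unique (I⊆S _) (I-independent _ _) large
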